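{- Let $\mathcal{GO}=\langle t,\prec,\phi\rangle$ be a GOMT problem with $\phi$ satisfiable, and let $\langle\mathcal{I},\Delta,\tau\rangle$ be a state in a $\mathcal{GO}$-derivation. Then for every formula $\tau_i$ occurring in $\tau$, $\phi\models_{\mathcal{T}}(\tau_i\Rightarrow\Delta)$.
   Context: Fix a many-sorted first-order theory $\mathcal{T}$ with signature $\Sigma$; interpretations are $\mathcal{T}$-interpretations assigning values to all variables, and $\models$ means $\models_{\mathcal{T}}$ ($\alpha\models\beta$: every $\mathcal{T}$-interpretation satisfying $\alpha$ satisfies $\beta$). A GOMT problem is $\mathcal{GO}=\langle t,\prec,\phi\rangle$: $t$ a $\Sigma$-term of sort $\sigma$, $\prec$ a strict partial order on values of sort $\sigma$ definable in $\mathcal{T}$, $\phi$ a $\Sigma$-formula. $\mathcal{I}$ is $\mathcal{GO}$-consistent if $\mathcal{I}\models\phi$; $\mathcal{I}<_{\mathcal{GO}}\mathcal{I}'$ if both are $\mathcal{GO}$-consistent and $t^{\mathcal{I}}\prec t^{\mathcal{I}'}$. $\textsc{Solve}$ maps a formula to an interpretation satisfying it if satisfiable, else to $\bot$. $\textsc{Better}$ maps each $\mathcal{GO}$-consistent $\mathcal{I}$ to a formula with: for every $\mathcal{GO}$-consistent $\mathcal{I}'$, $\mathcal{I}'\models\textsc{Better}(\mathcal{I})$ iff $\mathcal{I}'<_{\mathcal{GO}}\mathcal{I}$. $\textsc{Top}(s_1,\dots,s_n)=s_1$, $\textsc{Pop}(s_1,\dots,s_n)=(s_2,\dots,s_n)$,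 $\emptyset$ the empty sequence, $\circ$ concatenation. A state is $\langle\mathcal{I},\Delta,\tau\rangle$ (interpretation, formula, finite sequence of formulas). Initial state: $\mathcal{I}_0=\textsc{Solve}(\phi)$, $\Delta_0=\textsc{Better}(\mathcal{I}_0)$, $\tau_0=(\Delta_0)$. Rules (unmentioned components unchanged): F-Split: if $\tau\neq\emptyset$, $\psi=\textsc{Top}(\tau)$, $\phi\models\psi\Leftrightarrow\bigvee_{j=1}^k\psi_j$, $k\ge1$, then $\tau:=(\psi_1,\dots,\psi_k)\circ\textsc{Pop}(\tau)$. F-Sat: if $\tau\neq\emptyset$, $\psi=\textsc{Top}(\tau)$, $\textsc{Solve}(\phi\wedge\psi)=\mathcal{I}'\neq\bot$, $\Delta'=\Delta\wedge\textsc{Better}(\mathcal{I}')$, then $\mathcal{I}:=\mathcal{I}'$, $\Delta:=\Delta'$, $\tau:=(\Delta')$. F-Close: if $\tau\neq\emptyset$, $\psi=\textsc{Top}(\tau)$, $\textsc{Solve}(\phi\wedge\psi)=\bot$, then $\Delta:=\Delta\wedge\neg\psi$, $\tau:=\textsc{Pop}(\tau)$. A rule applies if its premises hold and the resulting state differs. A $\mathcal{GO}$-derivation is a sequence of states starting at the initial state, each obtained from the previous by one rule. -}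

module Defs where

open import Data.Product using (_×_; ∃; _,_)
open import Data.Maybe using (Maybe; just; nothing)
open import Data.List using (List; []; _∷_; _++_)
open import Data.List.NonEmpty using (List⁺; toList)
open import Data.List.Relation.Unary.Any using (Any)
open import Function.Bundles using (_⇔_)
open import Relation.Nullary using (¬_)
open import Relation.Binary.PropositionalEquality using (_≡_)
open import Relation.Binary.Structures using (IsStrictPartialOrder)
open import Relation.Binary.Construct.Closure.ReflexiveTransitive using (Star)

-- An abstract (many-sorted, first-order) theory T, presented semantically:
-- the T-interpretations (assigning values to all variables), the Σ-formulas,
-- the satisfaction relation ⊨, and the connectives with their standard meaning.
record Logic : Set₁ where
  infixr 6 _∧ᶠ_
  infixr 5 _⇒ᶠ_ _⇔ᶠ_
  field
    Interp  : Set
    Formula : Set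
    _⊨_     : Interp → Formula → Set
    _∧ᶠ_    : Formula → Formula → Formula
    _⇒ᶠ_    : Formula → Formula → Formula
    _⇔ᶠ_    : Formula → Formula → Formula
    ¬ᶠ_     : Formula → Formula
    ⋁ᶠ      : List⁺ Formula → Formula
    sem-∧   : ∀ I a b → (I ⊨ (a ∧ᶠ b)) ⇔ ((I ⊨ a) × (I ⊨ b))
    sem-⇒   : ∀ I a b → (I ⊨ (a ⇒ᶠ b)) ⇔ ((I ⊨ a) → (I ⊨ b))
    sem-⇔   : ∀ I a b → (I ⊨ (a ⇔ᶠ b)) ⇔ (((I ⊨ a) → (I ⊨ b)) × ((I ⊨ b) → (I ⊨ a)))
    sem-¬   : ∀ I a → (I ⊨ (¬ᶠ a)) ⇔ (¬ (I ⊨ a))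
    sem-⋁   : ∀ I ψs → (I ⊨ ⋁ᶠ ψs) ⇔ Any (I ⊨_) (toList ψs)

  _⊨ᵀ_ : Formula → Formula → Set
  α ⊨ᵀ β = ∀ I → I ⊨ α → I ⊨ β

  Satisfiable : Formula → Set
  Satisfiable α = ∃ λ I → I ⊨ α

record GOMT (L : Logic) : Set₁ where
  open Logic L
  field
    Val   : Set                      -- values of the sort σ of t
    t     : Interp → Val
    _≺_   : Val → Val → Set
    ≺-spo : IsStrictPartialOrder _≡_ _≺_
    φ     : Formula

  Consistent : Interp → Set
  Consistent I = I ⊨ φ

  _<GO_ : Interp → Interp → Set
  I <GO I′ = Consistent I × Consistent I′ × (t I ≺ t I′)

  field
    Solve          : Formula → Maybe Interp
    Solve-sat      : ∀ α I → Solve α ≡ just I → I ⊨ α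
    Solve-unsat    : ∀ α → Solve α ≡ nothing → ¬ Satisfiable α
    Better         : Interp → Formula
    Better-spec    : ∀ I → Consistent I → ∀ I′ → Consistent I′ →
                     (I′ ⊨ Better I) ⇔ (I′ <GO I)

module Derivation {L : Logic} (G : GOMT L) where
  open Logic L
  open GOMT G

  record State : Set where
    constructor ⟨_,_,_⟩
    field
      I : Interp
      Δ : Formula
      τ : List Formula

  open State public

  -- initial state, given I₀ = Solve(φ) (φ satisfiable, so Solve φ ≠ ⊥)
  initial : Interp → State
  initial I₀ = ⟨ I₀ , Better I₀ , Better I₀ ∷ [] ⟩

  -- one rule application; a rule applies only if the resulting state differs
  data _⟶_ : State → State → Set where
    F-Split : ∀ {I Δ ψ τ} (ψs : List⁺ Formula) →
              φ ⊨ᵀ (ψ ⇔ᶠ ⋁ᶠ ψs) →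
              ¬ (⟨ I , Δ , ψ ∷ τ ⟩ ≡ ⟨ I , Δ , toList ψs ++ τ ⟩) →
              ⟨ I , Δ , ψ ∷ τ ⟩ ⟶ ⟨ I , Δ , toList ψs ++ τ ⟩
    F-Sat   : ∀ {I Δ ψ τ} I′ →
              Solve (φ ∧ᶠ ψ) ≡ just I′ →
              ¬ (⟨ I , Δ , ψ ∷ τ ⟩ ≡ ⟨ I′ , Δ ∧ᶠ Better I′ , (Δ ∧ᶠ Better I′) ∷ [] ⟩) →
              ⟨ I , Δ , ψ ∷ τ ⟩ ⟶ ⟨ I′ , Δ ∧ᶠ Better I′ , (Δ ∧ᶠ Better I′) ∷ [] ⟩
    F-Close : ∀ {I Δ ψ τ} →
              Solve (φ ∧ᶠ ψ) ≡ nothing →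
              ¬ (⟨ I , Δ , ψ ∷ τ ⟩ ≡ ⟨ I , Δ ∧ᶠ (¬ᶠ ψ) , τ ⟩) →
              ⟨ I , Δ , ψ ∷ τ ⟩ ⟶ ⟨ I , Δ ∧ᶠ (¬ᶠ ψ) , τ ⟩

  InDerivation : Interp → State → Set
  InDerivation I₀ s = Star _⟶_ (initial I₀) s

module Submission where

-- The claim is an invariant of the rules.  Initially τ = (Δ), and F-Sat resets τ to (Δ′).
-- F-Split replaces the top ψ by disjuncts ψⱼ with φ ⊨ ψ ⇔ ⋁ ψⱼ, so each ψⱼ entails
-- whatever ψ did.  F-Close strengthens Δ to Δ ∧ ¬ψ, which the remaining formulas still
-- entail modulo φ because φ ∧ ψ is unsatisfiable.

open import Defs
open import Data.Maybe using (just)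
open import Data.List.NonEmpty using (List⁺; toList)
open import Data.List.Membership.Propositional using (_∈_; lose)
open import Data.List.Membership.Propositional.Properties using (∈-++⁻)
open import Data.List.Relation.Unary.Any using (here; there)
open import Data.Product using (_,_; proj₂)
open import Data.Sum using (inj₁; inj₂)
open import Function.Base using (id; _∘_)
open import Function.Bundles using (Equivalence)
open import Relation.Nullary using (¬_)
open import Relation.Binary.PropositionalEquality using (_≡_; refl)
open import Relation.Binary.Construct.Closure.ReflexiveTransitive using (fold)

module Entailment (L : Logic) where
  open Logic L
  open Equivalence

  _⊨_⇒_ : Formula → Formula → Formula → Set
  φ ⊨ ψ ⇒ δ = φ ⊨ᵀ (ψ ⇒ᶠ δ)

  ⊨⇒-intro : ∀ {φ ψ δ} → (∀ I → I ⊨ φ → I ⊨ ψ → I ⊨ δ) → φ ⊨ ψ ⇒ δ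
  ⊨⇒-intro {ψ = ψ} {δ} f I Iφ = from (sem-⇒ I ψ δ) (f I Iφ)

  ⊨⇒-elim : ∀ {φ ψ δ} → φ ⊨ ψ ⇒ δ → ∀ I → I ⊨ φ → I ⊨ ψ → I ⊨ δ
  ⊨⇒-elim {ψ = ψ} {δ} h I Iφ = to (sem-⇒ I ψ δ) (h I Iφ)

  ⊨⇒-refl : ∀ {φ ψ} → φ ⊨ ψ ⇒ ψ
  ⊨⇒-refl = ⊨⇒-intro λ _ _ Iψ → Iψ

  ⊨⇒-disjunct : ∀ {φ ψ δ χ} (ψs : List⁺ Formula) → φ ⊨ᵀ (ψ ⇔ᶠ ⋁ᶠ ψs) →
                φ ⊨ ψ ⇒ δ → χ ∈ toList ψs → φ ⊨ χ ⇒ δ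
  ⊨⇒-disjunct {ψ = ψ} ψs φ⊨ψ⇔⋁ψs φ⊨ψ⇒δ χ∈ψs = ⊨⇒-intro λ I Iφ Iχ →
    let I⋁ψs = from (sem-⋁ I ψs) (lose χ∈ψs Iχ)
        Iψ   = proj₂ (to (sem-⇔ I ψ (⋁ᶠ ψs)) (φ⊨ψ⇔⋁ψs I Iφ)) I⋁ψs
    in ⊨⇒-elim φ⊨ψ⇒δ I Iφ Iψ

  ⊨⇒-∧¬ : ∀ {φ ψ δ χ} → ¬ Satisfiable (φ ∧ᶠ ψ) → φ ⊨ χ ⇒ δ → φ ⊨ χ ⇒ (δ ∧ᶠ (¬ᶠ ψ))
  ⊨⇒-∧¬ {φ} {ψ} {δ} φ∧ψ-unsat φ⊨χ⇒δ = ⊨⇒-intro λ I Iφ Iχ →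
    from (sem-∧ I δ (¬ᶠ ψ))
      ( ⊨⇒-elim φ⊨χ⇒δ I Iφ Iχ
      , from (sem-¬ I ψ) λ Iψ → φ∧ψ-unsat (I , from (sem-∧ I φ ψ) (Iφ , Iψ)))

module StackInvariant {L : Logic} (G : GOMT L) where
  open Logic L
  open GOMT G
  open Derivation G
  open Entailment L

  StackEntailsΔ : State → Set
  StackEntailsΔ s = ∀ ψ → ψ ∈ τ s → φ ⊨ ψ ⇒ Δ s

  initial-stackEntailsΔ : ∀ I₀ → StackEntailsΔ (initial I₀)
  initial-stackEntailsΔ I₀ _ (here refl) = ⊨⇒-refl

  ⟶-preserves : ∀ {s s′} → s ⟶ s′ → StackEntailsΔ s → StackEntailsΔ s′
  ⟶-preserves (F-Split {ψ = ψ} ψs φ⊨ψ⇔⋁ψs _) inv χ χ∈τ′ with ∈-++⁻ (toList ψs) χ∈τ′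
  ... | inj₁ χ∈ψs = ⊨⇒-disjunct ψs φ⊨ψ⇔⋁ψs (inv ψ (here refl)) χ∈ψs
  ... | inj₂ χ∈τ  = inv χ (there χ∈τ)
  ⟶-preserves (F-Sat _ _ _) _ _ (here refl) = ⊨⇒-refl
  ⟶-preserves (F-Close {ψ = ψ} unsat _) inv χ χ∈τ =
    ⊨⇒-∧¬ (Solve-unsat (φ ∧ᶠ ψ) unsat) (inv χ (there χ∈τ))

  derivation-stackEntailsΔ : ∀ I₀ s → InDerivation I₀ s → StackEntailsΔ s
  derivation-stackEntailsΔ I₀ _ derivation =
    fold (λ s s′ → StackEntailsΔ s → StackEntailsΔ s′)
         (λ step rest → rest ∘ ⟶-preserves step) id
         derivation (initial-stackEntailsΔ I₀)

lemma3 : (L : Logic) (G : GOMT L) →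
    let open Logic L
        open GOMT G
        open Derivation G
    in Satisfiable φ → ∀ (I₀ : Interp) → Solve φ ≡ just I₀ →
    ∀ (s : State) → InDerivation I₀ s →
    ∀ ψ → ψ ∈ τ s → φ ⊨ᵀ (ψ ⇒ᶠ Δ s)
lemma3 L G _ I₀ _ = StackInvariant.derivation-stackEntailsΔ G I₀
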